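{- There is an absolute constant $C>0$ such that for all positive integers $n$ and all positive even integers $r$ with $2r \le n$, every triangle-free subset of the $r$-distance graph of the $n$-dimensional hypercube contains at most $C\,\frac{r\,2^n}{n+1}$ vertices; that is, such subsets have $O\!\left(\frac{r2^n}{n+1}\right)$ vertices.
   Context: The $n$-dimensional hypercube has vertex set $\{0,1\}^n$. The Hamming distance of two $0$--$1$ sequences of the same length is the number of positions in which they differ. The $r$-distance graph of the $n$-dimensional hypercube is the graph on $\{0,1\}^n$ in which two vertices are adjacent if and only if their Hamming distance is exactly $r$. A subset of the vertices is triangle-free if it contains no three vertices that are pairwise at Hamming distance exactly $r$. -}

module Defs where

open import Data.Nat using (ℕ; zero; suc; _+_)
open import Data.Bool using (Bool; true; false)
open import Data.Vec using (Vec; []; _∷_)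
open import Data.List using (List)
open import Data.List.Membership.Propositional using (_∈_)
open import Relation.Nullary using (¬_)
open import Relation.Binary.PropositionalEquality using (_≡_)
open import Data.Product using (_×_)

Cube : ℕ → Set
Cube n = Vec Bool n

hamming : ∀ {n} → Cube n → Cube n → ℕ
hamming [] [] = 0
hamming (true ∷ x) (true ∷ y) = hamming x y
hamming (false ∷ x) (false ∷ y) = hamming x y
hamming (true ∷ x) (false ∷ y) = suc (hamming x y)
hamming (false ∷ x) (true ∷ y) = suc (hamming x y)

Adj : ∀ {n} → ℕ → Cube n → Cube n → Set
Adj r x y = hamming x y ≡ r

TriangleFree : ∀ {n} → ℕ → List (Cube n) → Set
TriangleFree r S =
  ∀ x y z → x ∈ S → y ∈ S → z ∈ S →
  ¬ (Adj r x y × Adj r y z × Adj r x z)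

module Submission where

open import Defs
open import Data.Nat using (ℕ; zero; suc; _+_; _*_; _^_; _≤_; _<_; z≤n; s≤s; NonZero; >-nonZero)
open import Data.Nat.Properties
open import Data.Nat.DivMod using (_/_; _%_; m≡m%n+[m/n]*n; m%n<n; m≥n⇒m/n>0)
open import Data.Nat.Divisibility using (_∣_; divides)
open import Data.Bool using (Bool; true; false; not; _xor_)
import Data.Bool as Bool
open import Data.Vec using ([]; _∷_; zipWith; replicate; _++_; head; tail)
open import Data.Vec.Properties using (∷-injectiveˡ; ∷-injectiveʳ; ≡-dec)
open import Data.Fin as Fin using (Fin; zero; suc)
import Data.Fin.Properties as Fin
import Data.List as List
open import Data.List using (List; []; _∷_; length; map; filter; cartesianProduct; allFin)
open import Data.List.Properties using (length-map; length-++; length-tabulate)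
open import Data.List.Membership.Propositional.Properties using (∈-cartesianProduct⁻)
open import Data.List.Relation.Unary.All as All using (All; []; _∷_)
import Data.List.Relation.Unary.All.Properties as All
open import Data.List.Relation.Unary.Unique.Propositional using (Unique; []; _∷_)
import Data.List.Relation.Unary.Unique.Propositional.Properties as Unique
open import Data.List.Membership.Propositional using (_∈_)
open import Data.Product using (Σ-syntax; ∃-syntax; _×_; _,_; proj₁; proj₂)
open import Data.Product.Properties using (×-≡,≡→≡)
open import Relation.Binary.PropositionalEquality
open import Relation.Nullary using (¬_; Dec; yes; no; does; _×-dec_)
open import Relation.Binary using (tri<; tri≈; tri>)
open import Data.Empty using (⊥-elim)
open import Function using (_∘_; id)

-- For r = 2m, the n-cube contains q = ⌊n/m⌋ words M₀, …, M_{q-1} pairwise at distance r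
-- (disjoint blocks of m ones). Every translate x ⊕ M of this equilateral family is again
-- equilateral, so a triangle-free S contains at most two of the points x ⊕ Mᵢ. Counting the
-- pairs (y, i) with y ∈ S by x = y ⊕ Mᵢ therefore gives |S| q ≤ 2 · 2ⁿ, and n + 1 ≤ q r.
-- The counting is an injection of S × Fin q into the (n+1)-cube: (y, i) is sent to x together
-- with the bit "x ⊕ Mⱼ ∈ S for some j < i", which separates the two indices sharing an x.

infixl 6 _⊕_

_⊕_ : ∀ {n} → Cube n → Cube n → Cube n
_⊕_ = zipWith _xor_

⊕-involutive : ∀ {n} (x a : Cube n) → x ⊕ a ⊕ a ≡ x
⊕-involutive [] [] = refl
⊕-involutive (true ∷ x) (true ∷ a) = cong (true ∷_) (⊕-involutive x a)
⊕-involutive (true ∷ x) (false ∷ a) = cong (true ∷_) (⊕-involutive x a)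
⊕-involutive (false ∷ x) (true ∷ a) = cong (false ∷_) (⊕-involutive x a)
⊕-involutive (false ∷ x) (false ∷ a) = cong (false ∷_) (⊕-involutive x a)

⊕-cancelʳ : ∀ {n} {x y : Cube n} a → x ⊕ a ≡ y ⊕ a → x ≡ y
⊕-cancelʳ {x = x} {y} a eq = begin
  x         ≡⟨ ⊕-involutive x a ⟨
  x ⊕ a ⊕ a ≡⟨ cong (_⊕ a) eq ⟩
  y ⊕ a ⊕ a ≡⟨ ⊕-involutive y a ⟩
  y         ∎
  where open ≡-Reasoning

hamming-refl : ∀ {n} (x : Cube n) → hamming x x ≡ 0
hamming-refl [] = refl
hamming-refl (true ∷ x) = hamming-refl x
hamming-refl (false ∷ x) = hamming-refl x

hamming-comm : ∀ {n} (x y : Cube n) → hamming x y ≡ hamming y x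
hamming-comm [] [] = refl
hamming-comm (true ∷ x) (true ∷ y) = hamming-comm x y
hamming-comm (true ∷ x) (false ∷ y) = cong suc (hamming-comm x y)
hamming-comm (false ∷ x) (true ∷ y) = cong suc (hamming-comm x y)
hamming-comm (false ∷ x) (false ∷ y) = hamming-comm x y

hamming-⊕ˡ : ∀ {n} (x a b : Cube n) → hamming (x ⊕ a) (x ⊕ b) ≡ hamming a b
hamming-⊕ˡ [] [] [] = refl
hamming-⊕ˡ (true ∷ x) (true ∷ a) (true ∷ b) = hamming-⊕ˡ x a b
hamming-⊕ˡ (true ∷ x) (true ∷ a) (false ∷ b) = cong suc (hamming-⊕ˡ x a b)
hamming-⊕ˡ (true ∷ x) (false ∷ a) (true ∷ b) = cong suc (hamming-⊕ˡ x a b)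
hamming-⊕ˡ (true ∷ x) (false ∷ a) (false ∷ b) = hamming-⊕ˡ x a b
hamming-⊕ˡ (false ∷ x) (true ∷ a) (true ∷ b) = hamming-⊕ˡ x a b
hamming-⊕ˡ (false ∷ x) (true ∷ a) (false ∷ b) = cong suc (hamming-⊕ˡ x a b)
hamming-⊕ˡ (false ∷ x) (false ∷ a) (true ∷ b) = cong suc (hamming-⊕ˡ x a b)
hamming-⊕ˡ (false ∷ x) (false ∷ a) (false ∷ b) = hamming-⊕ˡ x a b

hamming-++ : ∀ {m n} (a c : Cube m) (b d : Cube n) →
             hamming (a ++ b) (c ++ d) ≡ hamming a c + hamming b d
hamming-++ [] [] b d = refl
hamming-++ (true ∷ a) (true ∷ c) b d = hamming-++ a c b d
hamming-++ (true ∷ a) (false ∷ c) b d = cong suc (hamming-++ a c b d)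
hamming-++ (false ∷ a) (true ∷ c) b d = cong suc (hamming-++ a c b d)
hamming-++ (false ∷ a) (false ∷ c) b d = hamming-++ a c b d

hamming-replicate-not : ∀ m b → hamming (replicate m b) (replicate m (not b)) ≡ m
hamming-replicate-not zero b = refl
hamming-replicate-not (suc m) true = cong suc (hamming-replicate-not m true)
hamming-replicate-not (suc m) false = cong suc (hamming-replicate-not m false)

replicate-++ : ∀ {A : Set} m n (a : A) → replicate (m + n) a ≡ replicate m a ++ replicate n a
replicate-++ zero n a = refl
replicate-++ (suc m) n a = cong (a ∷_) (replicate-++ m n a)

module _ {A B : Set} {P : A → Set} {f : A → B}
         (f-injectiveOn : ∀ {x y} → P x → P y → f x ≡ f y → x ≡ y) where

  unique-map⁺ : ∀ {xs} → All P xs → Unique xs → Unique (map f xs)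
  unique-map⁺ [] [] = []
  unique-map⁺ (px ∷ pxs) (x∉xs ∷ u) =
    All.map⁺ (All.zipWith (λ (py , x≢y) → x≢y ∘ f-injectiveOn px py) (pxs , x∉xs))
      ∷ unique-map⁺ pxs u

length-cartesianProduct : ∀ {A B : Set} (xs : List A) (ys : List B) →
                          length (cartesianProduct xs ys) ≡ length xs * length ys
length-cartesianProduct [] ys = refl
length-cartesianProduct (x ∷ xs) ys = begin
  length (map (x ,_) ys List.++ cartesianProduct xs ys)   ≡⟨ length-++ (map (x ,_) ys) ⟩
  length (map (x ,_) ys) + length (cartesianProduct xs ys) ≡⟨ cong₂ _+_ (length-map (x ,_) ys)
                                                                    (length-cartesianProduct xs ys) ⟩
  length ys + length xs * length ys                        ∎
  where open ≡-Reasoning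

fiber : ∀ {n} → Bool → List (Cube (suc n)) → List (Cube n)
fiber b xs = map tail (filter (λ x → head x Bool.≟ b) xs)

length-fibers : ∀ {n} (xs : List (Cube (suc n))) →
                length (fiber true xs) + length (fiber false xs) ≡ length xs
length-fibers [] = refl
length-fibers ((true ∷ x) ∷ xs) = cong suc (length-fibers xs)
length-fibers ((false ∷ x) ∷ xs) =
  trans (+-suc (length (fiber true xs)) _) (cong suc (length-fibers xs))

fiber-unique : ∀ {n} b {xs : List (Cube (suc n))} → Unique xs → Unique (fiber b xs)
fiber-unique b {xs} u =
  unique-map⁺ tail-injectiveOn (All.all-filter (λ x → head x Bool.≟ b) xs) (Unique.filter⁺ _ u)
  where
  tail-injectiveOn : ∀ {x y : Cube (suc _)} →
                     head x ≡ b → head y ≡ b → tail x ≡ tail y → x ≡ y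
  tail-injectiveOn {_ ∷ _} {_ ∷ _} refl refl = cong (b ∷_)

unique⇒length≤2^ : ∀ n {xs : List (Cube n)} → Unique xs → length xs ≤ 2 ^ n
unique⇒length≤2^ zero [] = z≤n
unique⇒length≤2^ zero ([] ∷ []) = s≤s z≤n
unique⇒length≤2^ zero {[] ∷ [] ∷ _} ((x≢y ∷ _) ∷ _) = ⊥-elim (x≢y refl)
unique⇒length≤2^ (suc n) {xs} u = begin
  length xs
    ≡⟨ length-fibers xs ⟨
  length (fiber true xs) + length (fiber false xs)
    ≤⟨ +-mono-≤ (unique⇒length≤2^ n (fiber-unique true u))
                (unique⇒length≤2^ n (fiber-unique false u)) ⟩
  2 ^ n + 2 ^ n
    ≡⟨ cong (2 ^ n +_) (+-identityʳ (2 ^ n)) ⟨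
  2 ^ suc n ∎
  where open ≤-Reasoning

Equilateral : ∀ {k N} → ℕ → (Fin k → Cube N) → Set
Equilateral r M = ∀ i j → i ≢ j → hamming (M i) (M j) ≡ r

blocks : ∀ m q → Fin q → Cube (q * m)
blocks m (suc q) zero = replicate m true ++ replicate (q * m) false
blocks m (suc q) (suc i) = replicate m false ++ blocks m q i

hamming-zeros-blocks : ∀ m q i → hamming (replicate (q * m) false) (blocks m q i) ≡ m
hamming-zeros-blocks m (suc q) i = begin
  hamming (replicate (m + q * m) false) (blocks m (suc q) i)
    ≡⟨ cong (λ z → hamming z (blocks m (suc q) i)) (replicate-++ m (q * m) false) ⟩
  hamming (replicate m false ++ replicate (q * m) false) (blocks m (suc q) i)
    ≡⟨ blockwise i ⟩
  m ∎
  where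
  open ≡-Reasoning
  zeros = replicate (q * m) false
  blockwise : ∀ i → hamming (replicate m false ++ zeros) (blocks m (suc q) i) ≡ m
  blockwise zero = begin
    hamming (replicate m false ++ zeros) (replicate m true ++ zeros)
      ≡⟨ hamming-++ (replicate m false) _ zeros zeros ⟩
    hamming (replicate m false) (replicate m true) + hamming zeros zeros
      ≡⟨ cong₂ _+_ (hamming-replicate-not m false) (hamming-refl zeros) ⟩
    m + 0
      ≡⟨ +-identityʳ m ⟩
    m ∎
  blockwise (suc i) = begin
    hamming (replicate m false ++ zeros) (replicate m false ++ blocks m q i)
      ≡⟨ hamming-++ (replicate m false) _ zeros _ ⟩
    hamming (replicate m false) (replicate m false) + hamming zeros (blocks m q i)
      ≡⟨ cong₂ _+_ (hamming-refl (replicate m false)) (hamming-zeros-blocks m q i) ⟩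
    m ∎

hamming-blocks-zero-suc : ∀ m q j → hamming (blocks m (suc q) zero) (blocks m (suc q) (suc j)) ≡ m + m
hamming-blocks-zero-suc m q j = trans
  (hamming-++ (replicate m true) (replicate m false) (replicate (q * m) false) (blocks m q j))
  (cong₂ _+_ (hamming-replicate-not m true) (hamming-zeros-blocks m q j))

blocks-equilateral : ∀ m q → Equilateral (m + m) (blocks m q)
blocks-equilateral m (suc q) zero zero 0≢0 = ⊥-elim (0≢0 refl)
blocks-equilateral m (suc q) zero (suc j) _ = hamming-blocks-zero-suc m q j
blocks-equilateral m (suc q) (suc i) zero _ =
  trans (hamming-comm (blocks m (suc q) (suc i)) _) (hamming-blocks-zero-suc m q i)
blocks-equilateral m (suc q) (suc i) (suc j) i≢j = trans
  (hamming-++ (replicate m false) (replicate m false) (blocks m q i) (blocks m q j))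
  (cong₂ _+_ (hamming-refl (replicate m false)) (blocks-equilateral m q i j (i≢j ∘ cong suc)))

padˡ-equilateral : ∀ {k N r} p {M : Fin k → Cube N} →
                   Equilateral r M → Equilateral r (λ i → replicate p false ++ M i)
padˡ-equilateral p {M} M-eq i j i≢j = trans
  (hamming-++ (replicate p false) (replicate p false) (M i) (M j))
  (cong₂ _+_ (hamming-refl (replicate p false)) (M-eq i j i≢j))

m+m≡m*2 : ∀ m → m + m ≡ m * 2
m+m≡m*2 m = trans (cong (m +_) (sym (*-identityʳ m))) (sym (*-suc m 1))

equilateralFamily : ∀ n m .{{_ : NonZero m}} → Σ[ M ∈ (Fin (n / m) → Cube n) ] Equilateral (m * 2) M
equilateralFamily n m = subst (λ d → Σ[ M ∈ (Fin (n / m) → Cube d) ] Equilateral (m * 2) M)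
  (sym (m≡m%n+[m/n]*n n m))
  (padded , subst (λ r → Equilateral r padded) (m+m≡m*2 m)
              (padˡ-equilateral (n % m) (blocks-equilateral m (n / m))))
  where
  padded : Fin (n / m) → Cube (n % m + n / m * m)
  padded i = replicate (n % m) false ++ blocks m (n / m) i

module _ {k N r} {M : Fin k → Cube N} (M-equilateral : Equilateral r M)
         {S : List (Cube N)} (S-triangleFree : TriangleFree r S) where

  no-three-translates : ∀ x {i j l : Fin k} → i Fin.< j → j Fin.< l →
                        x ⊕ M i ∈ S → x ⊕ M j ∈ S → ¬ (x ⊕ M l ∈ S)
  no-three-translates x {i} {j} {l} i<j j<l xi∈S xj∈S xl∈S =
    S-triangleFree _ _ _ xi∈S xj∈S xl∈S
      (distance i<j , distance j<l , distance (Fin.<-trans i<j j<l))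
    where
    distance : ∀ {a b} → a Fin.< b → hamming (x ⊕ M a) (x ⊕ M b) ≡ r
    distance {a} {b} a<b = trans (hamming-⊕ˡ x (M a) (M b)) (M-equilateral a b (Fin.<⇒≢ a<b))

  earlierTranslate? : ∀ (x : Cube N) (i : Fin k) → Dec (∃[ j ] (j Fin.< i × x ⊕ M j ∈ S))
  earlierTranslate? x i = Fin.any? (λ j → (j Fin.<? i) ×-dec (x ⊕ M j ∈? S))
    where open import Data.List.Membership.DecPropositional (≡-dec Bool._≟_) using (_∈?_)

  earlierTranslate-differs : ∀ x {i i' : Fin k} → i Fin.< i' → x ⊕ M i ∈ S → x ⊕ M i' ∈ S →
                             does (earlierTranslate? x i) ≢ does (earlierTranslate? x i')
  earlierTranslate-differs x {i} {i'} i<i' xi∈S xi'∈S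
    with earlierTranslate? x i | earlierTranslate? x i'
  ... | yes (j , j<i , xj∈S) | _ = λ _ → no-three-translates x j<i i<i' xj∈S xi∈S xi'∈S
  ... | no _ | yes _ = λ ()
  ... | no _ | no none-before-i' = λ _ → none-before-i' (i , i<i' , xi∈S)

  earlierTranslate-injectiveOn : ∀ x {i i' : Fin k} → x ⊕ M i ∈ S → x ⊕ M i' ∈ S →
                                 does (earlierTranslate? x i) ≡ does (earlierTranslate? x i') → i ≡ i'
  earlierTranslate-injectiveOn x {i} {i'} xi∈S xi'∈S same with Fin.<-cmp i i'
  ... | tri< i<i' _ _ = ⊥-elim (earlierTranslate-differs x i<i' xi∈S xi'∈S same)
  ... | tri≈ _ i≡i' _ = i≡i'
  ... | tri> _ _ i'<i = ⊥-elim (earlierTranslate-differs x i'<i xi'∈S xi∈S (sym same))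

  encode : Cube N × Fin k → Cube (suc N)
  encode (y , i) = does (earlierTranslate? (y ⊕ M i) i) ∷ y ⊕ M i

  encode-injectiveOn : ∀ {p q} → proj₁ p ∈ S → proj₁ q ∈ S → encode p ≡ encode q → p ≡ q
  encode-injectiveOn {y , i} {y' , i'} y∈S y'∈S eq = ×-≡,≡→≡ (y≡y' , i≡i')
    where
    x≡x' : y ⊕ M i ≡ y' ⊕ M i'
    x≡x' = ∷-injectiveʳ eq
    i≡i' : i ≡ i'
    i≡i' = earlierTranslate-injectiveOn (y ⊕ M i)
      (subst (_∈ S) (sym (⊕-involutive y (M i))) y∈S)
      (subst (_∈ S) (sym (trans (cong (_⊕ M i') x≡x') (⊕-involutive y' (M i')))) y'∈S)
      (trans (∷-injectiveˡ eq) (cong (λ x → does (earlierTranslate? x i')) (sym x≡x')))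
    y≡y' : y ≡ y'
    y≡y' = ⊕-cancelʳ (M i) (trans x≡x' (cong (λ j → y' ⊕ M j) (sym i≡i')))

  triangleFree-length*≤ : Unique S → length S * k ≤ 2 ^ suc N
  triangleFree-length*≤ S-unique = begin
    length S * k                    ≡⟨ cong (length S *_) (length-tabulate {n = k} id) ⟨
    length S * length (allFin k)    ≡⟨ length-cartesianProduct S (allFin k) ⟨
    length pairs                    ≡⟨ length-map encode pairs ⟨
    length (map encode pairs)       ≤⟨ unique⇒length≤2^ (suc N) (unique-map⁺ encode-injectiveOn
                                         (All.tabulate (proj₁ ∘ ∈-cartesianProduct⁻ S (allFin k)))
                                         (Unique.cartesianProduct⁺ S-unique (Unique.allFin⁺ k))) ⟩
    2 ^ suc N                       ∎
    where
    open ≤-Reasoning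
    pairs = cartesianProduct S (allFin k)

n+1≤[n/m]*[m*2] : ∀ n m .{{_ : NonZero m}} → m ≤ n → n + 1 ≤ n / m * (m * 2)
n+1≤[n/m]*[m*2] n m m≤n = begin
  n + 1                  ≡⟨ +-comm n 1 ⟩
  suc n                  ≡⟨ cong suc (m≡m%n+[m/n]*n n m) ⟩
  suc (n % m) + q * m    ≤⟨ +-monoˡ-≤ (q * m) (m%n<n n m) ⟩
  m + q * m              ≤⟨ +-monoˡ-≤ (q * m) (m≤n*m m q {{>-nonZero (m≥n⇒m/n>0 m≤n)}}) ⟩
  q * m + q * m          ≡⟨ *-distribˡ-+ q m m ⟨
  q * (m + m)            ≡⟨ cong (q *_) (m+m≡m*2 m) ⟩
  q * (m * 2)            ∎
  where
  open ≤-Reasoning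
  q = n / m

triangleFree-bound : ∀ n m .{{_ : NonZero m}} → m ≤ n → (S : List (Cube n)) → Unique S →
                     TriangleFree (m * 2) S → length S * (n + 1) ≤ 2 * (m * 2 * 2 ^ n)
triangleFree-bound n m m≤n S S-unique S-triangleFree = begin
  length S * (n + 1)           ≤⟨ *-monoʳ-≤ (length S) (n+1≤[n/m]*[m*2] n m m≤n) ⟩
  length S * (n / m * (m * 2)) ≡⟨ *-assoc (length S) (n / m) (m * 2) ⟨
  length S * (n / m) * (m * 2) ≤⟨ *-monoˡ-≤ (m * 2) length*[n/m]≤ ⟩
  2 * 2 ^ n * (m * 2)          ≡⟨ *-assoc 2 (2 ^ n) (m * 2) ⟩
  2 * (2 ^ n * (m * 2))        ≡⟨ cong (2 *_) (*-comm (2 ^ n) (m * 2)) ⟩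
  2 * (m * 2 * 2 ^ n)          ∎
  where
  open ≤-Reasoning
  family = equilateralFamily n m
  length*[n/m]≤ : length S * (n / m) ≤ 2 ^ suc n
  length*[n/m]≤ = triangleFree-length*≤ {M = proj₁ family} (proj₂ family) S-triangleFree S-unique

mainTheorem4 : ∃[ C ] (0 < C × (∀ (n r : ℕ) → 0 < n → 0 < r → 2 ∣ r → 2 * r ≤ n →
    (S : List (Cube n)) → Unique S → TriangleFree r S →
    length S * (n + 1) ≤ C * (r * 2 ^ n)))
mainTheorem4 = 2 , s≤s z≤n , bound
  where
  bound : ∀ (n r : ℕ) → 0 < n → 0 < r → 2 ∣ r → 2 * r ≤ n →
          (S : List (Cube n)) → Unique S → TriangleFree r S →
          length S * (n + 1) ≤ 2 * (r * 2 ^ n)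
  bound n .(zero * 2) _ () (divides zero refl)
  bound n .(suc m * 2) _ _ (divides (suc m) refl) 2r≤n =
    triangleFree-bound n (suc m) (≤-trans (m≤m*n (suc m) 2) (≤-trans (m≤n*m (suc m * 2) 2) 2r≤n))
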